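{- Let $S$ be a set, let $\mathcal C=F^{\mathrm{LD}}_S$ be the free LD category on $S$, and let $\|\cdot\|$ be the rank function on $\mathcal C$ determined by a function $r:S\to\mathbb N_{>0}$. If $i,j\in\mathrm{Id}^\otimes$, $u,v\in\mathfrak Y$, $\vec A\in\mathcal C^{|u|}$, $\vec B\in\mathcal C^{|v|}$ satisfy $H^i_u(\vec A)=H^j_v(\vec B)$ and $\|L^i_u(\vec A)\|=\|L^j_v(\vec B)\|$, then $i=j$, $u=v$ and $\vec A=\vec B$.
   Context: The free (unitless) LD category $F^{\mathrm{LD}}_S$ on $S$: objects are the formal binary expressions built from elements of $S$ with two operations $\otimes$ and $\odot$ (so e.g. $A_1\otimes A_2=B_1\otimes B_2$ iff $A_i=B_i$, and no $\otimes$-expression equals a $\odot$-expression). Morphisms are generated by identities and components of $\alpha_{A,B,C}:A\otimes(B\otimes C)\to(A\otimes B)\otimes C$, its inverse, $\bar\alpha_{A,B,C}:A\odot(B\odot C)\to(A\odot B)\odot C$, its inverse, $\delta^l_{A,B,C}:A\otimes(B\odot C)\to(A\otimes B)\odot C$ and $\delta^r_{A,B,C}:(A\odot B)\otimes C\to A\odot(B\otimes C)$, under composition, $\otimes$ and $\odot$, modulo the relations of an LD category (category axioms, bifunctoriality, naturality, invertibility of $\alpha,\bar\alpha$, and eight pentagon axioms). The rank function is $\|s\|=r(s)$ for $s\in S$ and $\|X\otimes Y\|=\|X\odot Y\|=\|X\|+\|Y\|$. $\mathrm{Id}^\otimes$ is the class of identity morphisms of objects of the form $X\otimes Y$. $\mathfrak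 Y$ is the free monoid on letters $\alpha,\alpha^{ -1}$. For a morphism $f:H\to L\otimes R$ and $u\in\mathfrak Y$, objects (functorial in $\vec A\in\mathcal C^{|u|}$) $H^f_u(\vec A),L^f_u(\vec A)$ are defined by $H^f_\emptyset=H$, $L^f_\emptyset=L$, $R^f_\emptyset=R$; $H^f_{\alpha u}(\vec A)=A_1\otimes H^f_u(\vec A_{\ge2})$, $L^f_{\alpha u}(\vec A)=A_1\otimes L^f_u(\vec A_{\ge2})$, $R^f_{\alpha u}(\vec A)=R^f_u(\vec A_{\ge2})$; $H^f_{\alpha^{ -1}u}(\vec A)=H^f_u(\vec A_{\le|u|})\otimes A_{|u|+1}$, $L^f_{\alpha^{ -1}u}(\vec A)=L^f_u(\vec A_{\le|u|})$, $R^f_{\alpha^{ -1}u}(\vec A)=R^f_u(\vec A_{\le|u|})\otimes A_{|u|+1}$, where $\vec A_{\ge k}=(A_k,\dots,A_n)$ and $\vec A_{\le k}=(A_1,\dots,A_k)$. -}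

module Defs where

open import Data.Nat using (ℕ; _+_)
open import Data.List using (List; []; _∷_; length)
open import Data.Vec using (Vec; []; _∷_; head; tail; init; last)

-- Objects of the free LD category F^LD_S: formal binary expressions
-- over S built with ⊗ and ⊙ (free, so constructors are injective/disjoint).
data Obj (S : Set) : Set where
  var : S → Obj S
  _⊗_ : Obj S → Obj S → Obj S
  _⊙_ : Obj S → Obj S → Obj S

rank : {S : Set} → (S → ℕ) → Obj S → ℕ
rank r (var s) = r s
rank r (X ⊗ Y) = rank r X + rank r Y
rank r (X ⊙ Y) = rank r X + rank r Y

-- The class Id^⊗: identity morphisms id_{X⊗Y}.  Such a morphism is
-- determined by (and determines) its object X⊗Y, i.e. the pair (X , Y).
-- Viewed as f : H → L ⊗ R we have H = X ⊗ Y, L = X, R = Y.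
data Id⊗ (S : Set) : Set where
  id⊗ : Obj S → Obj S → Id⊗ S

Hd : {S : Set} → Id⊗ S → Obj S
Hd (id⊗ X Y) = X ⊗ Y

Ld : {S : Set} → Id⊗ S → Obj S
Ld (id⊗ X Y) = X

Rd : {S : Set} → Id⊗ S → Obj S
Rd (id⊗ X Y) = Y

data Letter : Set where
  α α⁻¹ : Letter

𝔜 : Set
𝔜 = List Letter

Hᵘ : {S : Set} → Obj S → (u : 𝔜) → Vec (Obj S) (length u) → Obj S
Hᵘ H []        []  = H
Hᵘ H (α ∷ u)   As  = head As ⊗ Hᵘ H u (tail As)
Hᵘ H (α⁻¹ ∷ u) As  = Hᵘ H u (init As) ⊗ last As

Lᵘ : {S : Set} → Obj S → (u : 𝔜) → Vec (Obj S) (length u) → Obj S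
Lᵘ L []        []  = L
Lᵘ L (α ∷ u)   As  = head As ⊗ Lᵘ L u (tail As)
Lᵘ L (α⁻¹ ∷ u) As  = Lᵘ L u (init As)

Rᵘ : {S : Set} → Obj S → (u : 𝔜) → Vec (Obj S) (length u) → Obj S
Rᵘ R []        []  = R
Rᵘ R (α ∷ u)   As  = Rᵘ R u (tail As)
Rᵘ R (α⁻¹ ∷ u) As  = Rᵘ R u (init As) ⊗ last As

H[_]_ : {S : Set} → Id⊗ S → (u : 𝔜) → Vec (Obj S) (length u) → Obj S
H[ i ] u = Hᵘ (Hd i) u

L[_]_ : {S : Set} → Id⊗ S → (u : 𝔜) → Vec (Obj S) (length u) → Obj S
L[ i ] u = Lᵘ (Ld i) u

{-# OPTIONS --safe #-}
-- H^i_u(A) is always a ⊗-product P ⊗ Q, and the first letter of u is read off by comparing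
-- ‖L^i_u(A)‖ with ‖P‖: for u = [] they are equal (P = L), after α the rank of L exceeds that
-- of P = A₁, and after α⁻¹ it is smaller than that of P = H^i_{u'}(A), which strictly contains
-- L^i_{u'}(A) because ranks are positive.  Once the first letters agree, both the object and
-- the rank equation descend to the tail of the words, so induction on u recovers everything.
module Submission where

open import Defs
open import Data.Nat using (ℕ; suc; _<_)
open import Data.Nat.Properties using (<-irrefl; <-asym; <-≤-trans; m≤m+n; m<m+n; +-monoʳ-<; +-cancelˡ-≡)
open import Data.List using ([]; _∷_; length; head)
open import Data.Maybe using (Maybe; nothing; just)
open import Data.Vec using (Vec; []; _∷_; init; last; initLast; _∷ʳ_)
open import Data.Product using (Σ; _×_; _,_)
open import Function using (_∘_)
open import Relation.Nullary using (contradiction)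
open import Relation.Binary.PropositionalEquality using (_≡_; refl; sym; cong; cong₂; subst; subst₂)

init-last-ext : ∀ {X : Set} {n} (xs ys : Vec X (suc n)) →
  init xs ≡ init ys → last xs ≡ last ys → xs ≡ ys
init-last-ext xs ys with initLast xs | initLast ys
... | _ , _ , refl | _ , _ , refl = cong₂ _∷ʳ_

module _ {S : Set} where

  ⊗-injective : ∀ {X Y X′ Y′ : Obj S} → X ⊗ Y ≡ X′ ⊗ Y′ → X ≡ X′ × Y ≡ Y′
  ⊗-injective refl = refl , refl

  Hd-injective : ∀ {i j : Id⊗ S} → Hd i ≡ Hd j → i ≡ j
  Hd-injective {id⊗ _ _} {id⊗ _ _} refl = refl

  -- junk value: the identity on objects that are not ⊗-products
  leftFactor : Obj S → Obj S
  leftFactor (X ⊗ _) = X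
  leftFactor X       = X

RankOrder : Maybe Letter → ℕ → ℕ → Set
RankOrder nothing    m n = m ≡ n
RankOrder (just α)   m n = n < m
RankOrder (just α⁻¹) m n = m < n

RankOrder-functional : ∀ x y {m n} → RankOrder x m n → RankOrder y m n → x ≡ y
RankOrder-functional nothing    nothing    _   _   = refl
RankOrder-functional nothing    (just α)   m≡n n<m = contradiction n<m (<-irrefl (sym m≡n))
RankOrder-functional nothing    (just α⁻¹) m≡n m<n = contradiction m<n (<-irrefl m≡n)
RankOrder-functional (just α)   nothing    n<m m≡n = contradiction n<m (<-irrefl (sym m≡n))
RankOrder-functional (just α)   (just α)   _   _   = refl
RankOrder-functional (just α)   (just α⁻¹) n<m m<n = contradiction m<n (<-asym n<m)
RankOrder-functional (just α⁻¹) nothing    m<n m≡n = contradiction m<n (<-irrefl m≡n)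
RankOrder-functional (just α⁻¹) (just α)   m<n n<m = contradiction m<n (<-asym n<m)
RankOrder-functional (just α⁻¹) (just α⁻¹) _   _   = refl

module _ {S : Set} (r : S → ℕ) (r-positive : ∀ s → 0 < r s) where

  rank-positive : ∀ X → 0 < rank r X
  rank-positive (var s) = r-positive s
  rank-positive (X ⊗ Y) = <-≤-trans (rank-positive X) (m≤m+n _ _)
  rank-positive (X ⊙ Y) = <-≤-trans (rank-positive X) (m≤m+n _ _)

  rank-L<rank-H : ∀ i u (A : Vec (Obj S) (length u)) →
    rank r ((L[ i ] u) A) < rank r ((H[ i ] u) A)
  rank-L<rank-H (id⊗ X Y) []        []      = m<m+n _ (rank-positive Y)
  rank-L<rank-H i         (α ∷ u)   (a ∷ A) = +-monoʳ-< (rank r a) (rank-L<rank-H i u A)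
  rank-L<rank-H i         (α⁻¹ ∷ u) A       = <-≤-trans (rank-L<rank-H i u (init A)) (m≤m+n _ _)

  rankOrder-L-H : ∀ i u (A : Vec (Obj S) (length u)) →
    RankOrder (head u) (rank r ((L[ i ] u) A)) (rank r (leftFactor ((H[ i ] u) A)))
  rankOrder-L-H (id⊗ X Y) []        []      = refl
  rankOrder-L-H i         (α ∷ u)   (a ∷ A) = m<m+n (rank r a) (rank-positive ((L[ i ] u) A))
  rankOrder-L-H i         (α⁻¹ ∷ u) A       = rank-L<rank-H i u (init A)

  head-determined : ∀ i j u v (A : Vec (Obj S) (length u)) (B : Vec (Obj S) (length v)) →
    (H[ i ] u) A ≡ (H[ j ] v) B →
    rank r ((L[ i ] u) A) ≡ rank r ((L[ j ] v) B) →
    head u ≡ head v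
  head-determined i j u v A B H≡ ‖L‖≡ = RankOrder-functional (head u) (head v)
    (rankOrder-L-H i u A)
    (subst₂ (RankOrder (head v)) (sym ‖L‖≡) (cong (rank r ∘ leftFactor) (sym H≡))
      (rankOrder-L-H j v B))

  H-L-injective : ∀ i j u v (A : Vec (Obj S) (length u)) (B : Vec (Obj S) (length v)) →
    (H[ i ] u) A ≡ (H[ j ] v) B →
    rank r ((L[ i ] u) A) ≡ rank r ((L[ j ] v) B) →
    i ≡ j × Σ (u ≡ v) (λ e → subst (λ w → Vec (Obj S) (length w)) e A ≡ B)
  H-L-injective i j [] [] [] [] H≡ _ = Hd-injective H≡ , refl , refl
  H-L-injective i j [] (_ ∷ v) [] B H≡ ‖L‖≡ =
    contradiction (head-determined i j [] (_ ∷ v) [] B H≡ ‖L‖≡) λ ()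
  H-L-injective i j (_ ∷ u) [] A [] H≡ ‖L‖≡ =
    contradiction (head-determined i j (_ ∷ u) [] A [] H≡ ‖L‖≡) λ ()
  H-L-injective i j (x ∷ u) (y ∷ v) A B H≡ ‖L‖≡
    with head-determined i j (x ∷ u) (y ∷ v) A B H≡ ‖L‖≡
  H-L-injective i j (α ∷ u) (α ∷ v) (a ∷ A) (b ∷ B) H≡ ‖L‖≡ | refl
    with refl , tail≡ ← ⊗-injective H≡
    with i≡j , refl , refl ← H-L-injective i j u v A B tail≡ (+-cancelˡ-≡ (rank r a) _ _ ‖L‖≡)
       = i≡j , refl , refl
  H-L-injective i j (α⁻¹ ∷ u) (α⁻¹ ∷ v) A B H≡ ‖L‖≡ | refl
    with init≡ , last≡ ← ⊗-injective H≡
    with i≡j , refl , initA≡initB ← H-L-injective i j u v (init A) (init B) init≡ ‖L‖≡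
       = i≡j , refl , init-last-ext A B initA≡initB last≡

lemma5p2 : (S : Set) (r : S → ℕ) → (∀ s → 0 < r s) →
    (i j : Id⊗ S) (u v : 𝔜)
    (A : Vec (Obj S) (length u)) (B : Vec (Obj S) (length v)) →
    (H[ i ] u) A ≡ (H[ j ] v) B →
    rank r ((L[ i ] u) A) ≡ rank r ((L[ j ] v) B) →
    i ≡ j × Σ (u ≡ v) (λ e → subst (λ w → Vec (Obj S) (length w)) e A ≡ B)
lemma5p2 S = H-L-injective
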